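{- Let $F$ be a finite field and $n>1$. If $A$ is a nonzero element of $M_n(F)$, then there exists a non-invertible $B\in M_n(F)$ such that $A-B$ is invertible.
   Context: $M_n(F)$ is the ring of $n\times n$ matrices over $F$. -}

module Defs where

open import Level using (Level; _⊔_)
open import Data.Nat using (ℕ; zero; suc)
open import Data.Fin using (Fin; zero; suc)
open import Data.Product using (Σ; ∃; _×_; _,_)
open import Relation.Nullary using (¬_)
open import Function.Bundles using (Inverse)
open import Relation.Binary.PropositionalEquality as ≡ using (_≡_)
open import Algebra.Bundles using (CommutativeRing)

private variable c ℓ : Level

record IsField (R : CommutativeRing c ℓ) : Set (c ⊔ ℓ) where
  open CommutativeRing R hiding (zero)
  field
    0≉1     : ¬ (0# ≈ 1#)
    inverse : ∀ x → ¬ (x ≈ 0#) → ∃ λ y → x * y ≈ 1#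

IsFinite : CommutativeRing c ℓ → Set (c ⊔ ℓ)
IsFinite R = ∃ λ (q : ℕ) → Inverse (CommutativeRing.setoid R) (≡.setoid (Fin q))

module Matrices (R : CommutativeRing c ℓ) where
  open CommutativeRing R hiding (zero)

  Mat : ℕ → Set c
  Mat n = Fin n → Fin n → Carrier

  ∑ : ∀ {n} → (Fin n → Carrier) → Carrier
  ∑ {zero}  f = 0#
  ∑ {suc n} f = f zero + ∑ (λ i → f (suc i))

  _≈ₘ_ : ∀ {n} → Mat n → Mat n → Set ℓ
  A ≈ₘ B = ∀ i j → A i j ≈ B i j

  0ₘ : ∀ {n} → Mat n
  0ₘ i j = 0#

  Iₘ : ∀ {n} → Mat n
  Iₘ i j with i Data.Fin.≟ j
  ... | Relation.Nullary.yes _ = 1#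
  ... | Relation.Nullary.no  _ = 0#

  _*ₘ_ : ∀ {n} → Mat n → Mat n → Mat n
  (A *ₘ B) i j = ∑ (λ k → A i k * B k j)

  _-ₘ_ : ∀ {n} → Mat n → Mat n → Mat n
  (A -ₘ B) i j = A i j - B i j

  Invertible : ∀ {n} → Mat n → Set (c ⊔ ℓ)
  Invertible {n} A = Σ (Mat n) λ B → (A *ₘ B) ≈ₘ Iₘ × (B *ₘ A) ≈ₘ Iₘ

-- Take an entry A i k ≠ 0 and let M be an invertible matrix whose i-th row is the i-th row
-- of A: a row permutation moving row k to row i, applied to the identity matrix with its
-- k-th row replaced by that row of A (invertible because its pivot A i k is a unit).
-- Then B = A - M has a zero row, so it is singular, while A - B = M is invertible.
-- Finiteness of F only serves to make equality decidable, so that a nonzero entry can be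
-- located.
module Submission where

open import Defs
open import Level using (Level)
open import Data.Nat using (ℕ; zero; suc; _>_)
open import Data.Fin using (Fin; zero; suc)
open import Data.Fin.Properties using (_≟_; suc-injective; ¬∀⟶∃¬; all?; inj⇒≟)
open import Data.Fin.Permutation using (Permutation; _⟨$⟩ʳ_; flip; inverseˡ; transpose)
open import Data.Vec.Functional using (updateAt)
open import Data.Vec.Functional.Properties using (updateAt-updates; updateAt-minimal)
open import Data.Product using (Σ; ∃₂; _×_; _,_)
open import Data.Empty using (⊥-elim)
open import Function.Base using (const; _∘_)
open import Function.Properties.Inverse using (Inverse⇒Injection)
open import Relation.Nullary using (¬_; Dec; yes; no)
open import Relation.Nullary.Decidable using (dec-true)
open import Relation.Binary.Bundles using (Setoid)
open import Relation.Binary.Definitions using (Decidable)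
open import Relation.Binary.PropositionalEquality as ≡ using (_≡_; _≢_)
open import Algebra.Bundles using (CommutativeRing)

transpose-matchˡ : ∀ {n} (i j : Fin n) → transpose i j ⟨$⟩ʳ i ≡ j
transpose-matchˡ i j rewrite dec-true (i ≟ i) ≡.refl = ≡.refl

module Sums {c ℓ : Level} (R : CommutativeRing c ℓ) where
  open CommutativeRing R hiding (zero)
  open Matrices R
  open import Algebra.Properties.Semiring.Sum semiring
    using (sum; sum-cong-≋; *-distribˡ-sum; *-distribʳ-sum) renaming (∑-comm to sum-comm)
  open import Relation.Binary.Reasoning.Setoid setoid

  ∑≡sum : ∀ {n} (f : Fin n → Carrier) → ∑ f ≡ sum f
  ∑≡sum {zero}  f = ≡.refl
  ∑≡sum {suc n} f = ≡.cong (f zero +_) (∑≡sum (f ∘ suc))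

  ∑-cong : ∀ {n} {f g : Fin n → Carrier} → (∀ b → f b ≈ g b) → ∑ f ≈ ∑ g
  ∑-cong {zero}  f≈g = refl
  ∑-cong {suc n} f≈g = +-cong (f≈g zero) (∑-cong (f≈g ∘ suc))

  ∑-zero : ∀ {n} {f : Fin n → Carrier} → (∀ b → f b ≈ 0#) → ∑ f ≈ 0#
  ∑-zero {zero}  f≈0 = refl
  ∑-zero {suc n} f≈0 = trans (+-cong (f≈0 zero) (∑-zero (f≈0 ∘ suc))) (+-identityˡ 0#)

  ∑-single : ∀ {n} {f : Fin n → Carrier} j → (∀ b → b ≢ j → f b ≈ 0#) → ∑ f ≈ f j
  ∑-single zero    f≈0 = trans (+-congˡ (∑-zero λ b → f≈0 (suc b) λ ())) (+-identityʳ _)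
  ∑-single (suc j) f≈0 =
    trans (+-cong (f≈0 zero λ ()) (∑-single j λ b b≢j → f≈0 (suc b) (b≢j ∘ suc-injective)))
          (+-identityˡ _)

  ∑-pair : ∀ {n} {f : Fin n → Carrier} j j' → j ≢ j' →
           (∀ b → b ≢ j → b ≢ j' → f b ≈ 0#) → ∑ f ≈ f j + f j'
  ∑-pair zero    zero     j≢j' _   = ⊥-elim (j≢j' ≡.refl)
  ∑-pair zero    (suc j') _    f≈0 =
    +-congˡ (∑-single j' λ b b≢j' → f≈0 (suc b) (λ ()) (b≢j' ∘ suc-injective))
  ∑-pair (suc j) zero     _    f≈0 =
    trans (+-congˡ (∑-single j λ b b≢j → f≈0 (suc b) (b≢j ∘ suc-injective) (λ ()))) (+-comm _ _)
  ∑-pair (suc j) (suc j') j≢j' f≈0 =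
    trans (+-cong (f≈0 zero (λ ()) (λ ()))
                  (∑-pair j j' (j≢j' ∘ ≡.cong suc) λ b b≢j b≢j' →
                     f≈0 (suc b) (b≢j ∘ suc-injective) (b≢j' ∘ suc-injective)))
          (+-identityˡ _)

  *-distribˡ-∑ : ∀ {n} x (f : Fin n → Carrier) → x * ∑ f ≈ ∑ (λ b → x * f b)
  *-distribˡ-∑ x f = begin
    x * ∑ f              ≡⟨ ≡.cong (x *_) (∑≡sum f) ⟩
    x * sum f            ≈⟨ *-distribˡ-sum x f ⟩
    sum (λ b → x * f b)  ≡⟨ ∑≡sum (λ b → x * f b) ⟨
    ∑ (λ b → x * f b)    ∎

  *-distribʳ-∑ : ∀ {n} x (f : Fin n → Carrier) → ∑ f * x ≈ ∑ (λ b → f b * x)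
  *-distribʳ-∑ x f = begin
    ∑ f * x              ≡⟨ ≡.cong (_* x) (∑≡sum f) ⟩
    sum f * x            ≈⟨ *-distribʳ-sum x f ⟩
    sum (λ b → f b * x)  ≡⟨ ∑≡sum (λ b → f b * x) ⟨
    ∑ (λ b → f b * x)    ∎

  ∑-comm : ∀ {m n} (f : Fin m → Fin n → Carrier) →
           ∑ (λ a → ∑ (f a)) ≈ ∑ (λ b → ∑ (λ a → f a b))
  ∑-comm f = begin
    ∑ (λ a → ∑ (f a))                ≡⟨ ∑≡sum (λ a → ∑ (f a)) ⟩
    sum (λ a → ∑ (f a))              ≈⟨ sum-cong-≋ (λ a → reflexive (∑≡sum (f a))) ⟩
    sum (λ a → sum (f a))            ≈⟨ sum-comm f ⟩
    sum (λ b → sum (λ a → f a b))    ≈⟨ sum-cong-≋ (λ b → reflexive (∑≡sum (λ a → f a b))) ⟨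
    sum (λ b → ∑ (λ a → f a b))      ≡⟨ ∑≡sum (λ b → ∑ (λ a → f a b)) ⟨
    ∑ (λ b → ∑ (λ a → f a b))        ∎

module MatrixAlgebra {c ℓ : Level} (R : CommutativeRing c ℓ) where
  open CommutativeRing R hiding (zero)
  open Matrices R
  open Sums R
  open import Algebra.Properties.Ring ring using (-‿distribʳ-*; ⁻¹-anti-homo‿-; xyx⁻¹≈y)

  ≈ₘ-refl : ∀ {n} {X : Mat n} → X ≈ₘ X
  ≈ₘ-refl _ _ = refl

  ≈ₘ-sym : ∀ {n} {X Y : Mat n} → X ≈ₘ Y → Y ≈ₘ X
  ≈ₘ-sym X≈Y a b = sym (X≈Y a b)

  ≈ₘ-trans : ∀ {n} {X Y Z : Mat n} → X ≈ₘ Y → Y ≈ₘ Z → X ≈ₘ Z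
  ≈ₘ-trans X≈Y Y≈Z a b = trans (X≈Y a b) (Y≈Z a b)

  ≈ₘ-setoid : ℕ → Setoid c ℓ
  ≈ₘ-setoid n = record
    { Carrier       = Mat n
    ; _≈_           = _≈ₘ_
    ; isEquivalence = record { refl = ≈ₘ-refl ; sym = ≈ₘ-sym ; trans = ≈ₘ-trans }
    }

  Iₘ-diagonal : ∀ {n} (a : Fin n) → Iₘ a a ≈ 1#
  Iₘ-diagonal a with a ≟ a
  ... | yes _   = refl
  ... | no a≢a = ⊥-elim (a≢a ≡.refl)

  Iₘ-offDiagonal : ∀ {n} {a b : Fin n} → a ≢ b → Iₘ a b ≈ 0#
  Iₘ-offDiagonal {a = a} {b} a≢b with a ≟ b
  ... | yes a≡b = ⊥-elim (a≢b a≡b)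
  ... | no _    = refl

  *ₘ-cong : ∀ {n} {X X' Y Y' : Mat n} → X ≈ₘ X' → Y ≈ₘ Y' → (X *ₘ Y) ≈ₘ (X' *ₘ Y')
  *ₘ-cong X≈X' Y≈Y' a c = ∑-cong λ b → *-cong (X≈X' a b) (Y≈Y' b c)

  *ₘ-identityˡ : ∀ {n} (X : Mat n) → (Iₘ *ₘ X) ≈ₘ X
  *ₘ-identityˡ X a c = begin
    ∑ (λ b → Iₘ a b * X b c)  ≈⟨ ∑-single a off-diagonal ⟩
    Iₘ a a * X a c            ≈⟨ *-congʳ (Iₘ-diagonal a) ⟩
    1# * X a c                ≈⟨ *-identityˡ _ ⟩
    X a c                     ∎
    where
    open import Relation.Binary.Reasoning.Setoid setoid
    off-diagonal : ∀ b → b ≢ a → Iₘ a b * X b c ≈ 0#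
    off-diagonal b b≢a = trans (*-congʳ (Iₘ-offDiagonal (b≢a ∘ ≡.sym))) (zeroˡ (X b c))

  *ₘ-assoc : ∀ {n} (X Y Z : Mat n) → ((X *ₘ Y) *ₘ Z) ≈ₘ (X *ₘ (Y *ₘ Z))
  *ₘ-assoc X Y Z a c = begin
    ∑ (λ l → ∑ (λ k → X a k * Y k l) * Z l c)
      ≈⟨ ∑-cong (λ l → *-distribʳ-∑ (Z l c) (λ k → X a k * Y k l)) ⟩
    ∑ (λ l → ∑ (λ k → X a k * Y k l * Z l c))
      ≈⟨ ∑-comm (λ l k → X a k * Y k l * Z l c) ⟩
    ∑ (λ k → ∑ (λ l → X a k * Y k l * Z l c))
      ≈⟨ ∑-cong (λ k → ∑-cong λ l → *-assoc (X a k) (Y k l) (Z l c)) ⟩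
    ∑ (λ k → ∑ (λ l → X a k * (Y k l * Z l c)))
      ≈⟨ ∑-cong (λ k → *-distribˡ-∑ (X a k) (λ l → Y k l * Z l c)) ⟨
    ∑ (λ k → X a k * ∑ (λ l → Y k l * Z l c))
      ∎
    where open import Relation.Binary.Reasoning.Setoid setoid

  X-[X-Y]≈Y : ∀ {n} (X Y : Mat n) → (X -ₘ (X -ₘ Y)) ≈ₘ Y
  X-[X-Y]≈Y X Y a b =
    trans (+-congˡ (⁻¹-anti-homo‿- (X a b) (Y a b)))
          (trans (sym (+-assoc _ _ _)) (xyx⁻¹≈y (X a b) (Y a b)))

  Invertible-cong : ∀ {n} {X Y : Mat n} → X ≈ₘ Y → Invertible Y → Invertible X
  Invertible-cong X≈Y (Y⁻¹ , YY⁻¹≈I , Y⁻¹Y≈I) =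
    Y⁻¹ , ≈ₘ-trans (*ₘ-cong X≈Y ≈ₘ-refl) YY⁻¹≈I , ≈ₘ-trans (*ₘ-cong ≈ₘ-refl X≈Y) Y⁻¹Y≈I

  Invertible-*ₘ : ∀ {n} {X Y : Mat n} → Invertible X → Invertible Y → Invertible (X *ₘ Y)
  Invertible-*ₘ (X⁻¹ , XX⁻¹≈I , X⁻¹X≈I) (Y⁻¹ , YY⁻¹≈I , Y⁻¹Y≈I) =
    Y⁻¹ *ₘ X⁻¹ , cancel-middle YY⁻¹≈I XX⁻¹≈I , cancel-middle X⁻¹X≈I Y⁻¹Y≈I
    where
    cancel-middle : ∀ {n} {P P' Q Q' : Mat n} → (Q *ₘ Q') ≈ₘ Iₘ → (P *ₘ P') ≈ₘ Iₘ →
                    ((P *ₘ Q) *ₘ (Q' *ₘ P')) ≈ₘ Iₘ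
    cancel-middle {n} {P} {P'} {Q} {Q'} QQ'≈I PP'≈I = begin
      (P *ₘ Q) *ₘ (Q' *ₘ P')  ≈⟨ *ₘ-assoc P Q (Q' *ₘ P') ⟩
      P *ₘ (Q *ₘ (Q' *ₘ P'))  ≈⟨ *ₘ-cong ≈ₘ-refl (*ₘ-assoc Q Q' P') ⟨
      P *ₘ ((Q *ₘ Q') *ₘ P')  ≈⟨ *ₘ-cong ≈ₘ-refl (*ₘ-cong QQ'≈I ≈ₘ-refl) ⟩
      P *ₘ (Iₘ *ₘ P')         ≈⟨ *ₘ-cong ≈ₘ-refl (*ₘ-identityˡ P') ⟩
      P *ₘ P'                 ≈⟨ PP'≈I ⟩
      Iₘ                      ∎
      where open import Relation.Binary.Reasoning.Setoid (≈ₘ-setoid n)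

  zeroRow⇒¬Invertible : ¬ (0# ≈ 1#) → ∀ {n} (X : Mat n) i → (∀ b → X i b ≈ 0#) → ¬ Invertible X
  zeroRow⇒¬Invertible 0≉1 X i Xᵢ≈0 (X⁻¹ , XX⁻¹≈I , _) = 0≉1 (begin
    0#                          ≈⟨ ∑-zero (λ b → trans (*-congʳ (Xᵢ≈0 b)) (zeroˡ _)) ⟨
    ∑ (λ b → X i b * X⁻¹ b i)   ≈⟨ XX⁻¹≈I i i ⟩
    Iₘ i i                      ≈⟨ Iₘ-diagonal i ⟩
    1#                          ∎)
    where open import Relation.Binary.Reasoning.Setoid setoid

  permutationMatrix : ∀ {n} → Permutation n n → Mat n
  permutationMatrix π a = Iₘ (π ⟨$⟩ʳ a)

  permutationMatrix-*ₘ : ∀ {n} (π : Permutation n n) (X : Mat n) →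
                         (permutationMatrix π *ₘ X) ≈ₘ (X ∘ (π ⟨$⟩ʳ_))
  permutationMatrix-*ₘ π X a = *ₘ-identityˡ X (π ⟨$⟩ʳ a)

  permutationMatrix-inverse : ∀ {n} (π : Permutation n n) →
                              (permutationMatrix π *ₘ permutationMatrix (flip π)) ≈ₘ Iₘ
  permutationMatrix-inverse π a c =
    trans (permutationMatrix-*ₘ π (permutationMatrix (flip π)) a c)
          (reflexive (≡.cong (λ x → Iₘ x c) (inverseˡ π)))

  Invertible-permutationMatrix : ∀ {n} (π : Permutation n n) → Invertible (permutationMatrix π)
  Invertible-permutationMatrix π =
    permutationMatrix (flip π) , permutationMatrix-inverse π , permutationMatrix-inverse (flip π)

  Iₘ-withRow : ∀ {n} → Fin n → (Fin n → Carrier) → Mat n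
  Iₘ-withRow p v = updateAt Iₘ p (const v)

  Iₘ-withRow-self : ∀ {n} (p : Fin n) (v : Fin n → Carrier) → Iₘ-withRow p v p ≡ v
  Iₘ-withRow-self p v = updateAt-updates p Iₘ

  Iₘ-withRow-other : ∀ {n} {p a : Fin n} (v : Fin n → Carrier) → a ≢ p → Iₘ-withRow p v a ≡ Iₘ a
  Iₘ-withRow-other {p = p} {a} v a≢p = updateAt-minimal a p Iₘ a≢p

  Iₘ-withRow-*ₘ-other : ∀ {n} {p a : Fin n} (v : Fin n → Carrier) (X : Mat n) → a ≢ p →
                        ∀ c → (Iₘ-withRow p v *ₘ X) a c ≈ X a c
  Iₘ-withRow-*ₘ-other v X a≢p c =
    trans (reflexive (≡.cong (λ row → ∑ λ b → row b * X b c) (Iₘ-withRow-other v a≢p)))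
          (*ₘ-identityˡ X _ c)

  ∑-*-Iₘ-withRow-pivot : ∀ {n} (p : Fin n) (x w : Fin n → Carrier) →
                         ∑ (λ b → x b * Iₘ-withRow p w b p) ≈ x p * w p
  ∑-*-Iₘ-withRow-pivot p x w = begin
    ∑ (λ b → x b * Iₘ-withRow p w b p)  ≈⟨ ∑-single p off-pivot ⟩
    x p * Iₘ-withRow p w p p            ≡⟨ ≡.cong (λ row → x p * row p) (Iₘ-withRow-self p w) ⟩
    x p * w p                           ∎
    where
    open import Relation.Binary.Reasoning.Setoid setoid
    off-pivot : ∀ b → b ≢ p → x b * Iₘ-withRow p w b p ≈ 0#
    off-pivot b b≢p = trans (*-congˡ (trans (reflexive (≡.cong-app (Iₘ-withRow-other w b≢p) p))
                                            (Iₘ-offDiagonal b≢p)))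
                            (zeroʳ _)

  ∑-*-Iₘ-withRow-other : ∀ {n} (p : Fin n) (x w : Fin n → Carrier) {c} → c ≢ p →
                         ∑ (λ b → x b * Iₘ-withRow p w b c) ≈ x p * w c + x c
  ∑-*-Iₘ-withRow-other p x w {c} c≢p = begin
    ∑ (λ b → x b * Iₘ-withRow p w b c)
      ≈⟨ ∑-pair p c (c≢p ∘ ≡.sym) off-support ⟩
    x p * Iₘ-withRow p w p c + x c * Iₘ-withRow p w c c
      ≡⟨ ≡.cong₂ (λ rowₚ rowc → x p * rowₚ c + x c * rowc c)
                 (Iₘ-withRow-self p w) (Iₘ-withRow-other w c≢p) ⟩
    x p * w c + x c * Iₘ c c
      ≈⟨ +-congˡ (trans (*-congˡ (Iₘ-diagonal c)) (*-identityʳ (x c))) ⟩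
    x p * w c + x c
      ∎
    where
    open import Relation.Binary.Reasoning.Setoid setoid
    off-support : ∀ b → b ≢ p → b ≢ c → x b * Iₘ-withRow p w b c ≈ 0#
    off-support b b≢p b≢c = trans (*-congˡ (trans (reflexive (≡.cong-app (Iₘ-withRow-other w b≢p) c))
                                                  (Iₘ-offDiagonal b≢c)))
                                  (zeroʳ _)

  Iₘ-withRow-*ₘ-Iₘ-withRow : ∀ {n} (p : Fin n) (v w : Fin n → Carrier) → v p * w p ≈ 1# →
                             (∀ c → c ≢ p → v p * w c + v c ≈ 0#) →
                             (Iₘ-withRow p v *ₘ Iₘ-withRow p w) ≈ₘ Iₘ
  Iₘ-withRow-*ₘ-Iₘ-withRow p v w vₚwₚ≈1 vₚw+v≈0 a c with a ≟ p
  ... | no a≢p = trans (Iₘ-withRow-*ₘ-other v (Iₘ-withRow p w) a≢p c)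
                       (reflexive (≡.cong-app (Iₘ-withRow-other w a≢p) c))
  ... | yes ≡.refl = trans (reflexive (≡.cong (λ row → ∑ λ b → row b * Iₘ-withRow p w b c)
                                               (Iₘ-withRow-self p v)))
                           (pivot-row c (c ≟ p))
    where
    pivot-row : ∀ c → Dec (c ≡ p) → ∑ (λ b → v b * Iₘ-withRow p w b c) ≈ Iₘ p c
    pivot-row c (yes ≡.refl) = trans (∑-*-Iₘ-withRow-pivot p v w) (trans vₚwₚ≈1 (sym (Iₘ-diagonal p)))
    pivot-row c (no c≢p)     = trans (∑-*-Iₘ-withRow-other p v w c≢p)
                                     (trans (vₚw+v≈0 c c≢p) (sym (Iₘ-offDiagonal (c≢p ∘ ≡.sym))))

  inverseRow : ∀ {n} → Fin n → (Fin n → Carrier) → Carrier → Fin n → Carrier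
  inverseRow p v s = updateAt (λ c → - (s * v c)) p (const s)

  Invertible-Iₘ-withRow : ∀ {n} (p : Fin n) (v : Fin n → Carrier) {s} → v p * s ≈ 1# →
                          Invertible (Iₘ-withRow p v)
  Invertible-Iₘ-withRow p v {s} vₚs≈1 =
    Iₘ-withRow p w ,
    Iₘ-withRow-*ₘ-Iₘ-withRow p v w vₚwₚ≈1 vₚw+v≈0 ,
    Iₘ-withRow-*ₘ-Iₘ-withRow p w v wₚvₚ≈1 wₚv+w≈0
    where
    open import Relation.Binary.Reasoning.Setoid setoid
    w = inverseRow p v s

    wₚ≡s : w p ≡ s
    wₚ≡s = updateAt-updates p (λ c → - (s * v c))

    w-other : ∀ {c} → c ≢ p → w c ≡ - (s * v c)
    w-other {c} c≢p = updateAt-minimal c p (λ c → - (s * v c)) c≢p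

    vₚwₚ≈1 : v p * w p ≈ 1#
    vₚwₚ≈1 = trans (*-congˡ (reflexive wₚ≡s)) vₚs≈1

    wₚvₚ≈1 : w p * v p ≈ 1#
    wₚvₚ≈1 = trans (*-comm (w p) (v p)) vₚwₚ≈1

    vₚw+v≈0 : ∀ c → c ≢ p → v p * w c + v c ≈ 0#
    vₚw+v≈0 c c≢p = begin
      v p * w c + v c              ≡⟨ ≡.cong (λ x → v p * x + v c) (w-other c≢p) ⟩
      v p * - (s * v c) + v c      ≈⟨ +-congʳ (-‿distribʳ-* (v p) (s * v c)) ⟨
      - (v p * (s * v c)) + v c    ≈⟨ +-congʳ (-‿cong (*-assoc (v p) s (v c))) ⟨
      - (v p * s * v c) + v c      ≈⟨ +-congʳ (-‿cong (trans (*-congʳ vₚs≈1) (*-identityˡ (v c)))) ⟩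
      - v c + v c                  ≈⟨ -‿inverseˡ (v c) ⟩
      0#                           ∎

    wₚv+w≈0 : ∀ c → c ≢ p → w p * v c + w c ≈ 0#
    wₚv+w≈0 c c≢p = begin
      w p * v c + w c              ≡⟨ ≡.cong₂ (λ x y → x * v c + y) wₚ≡s (w-other c≢p) ⟩
      s * v c + - (s * v c)        ≈⟨ -‿inverseʳ (s * v c) ⟩
      0#                           ∎

  invertible-with-row : ∀ {n} (r : Fin n → Carrier) {k s} → r k * s ≈ 1# → (i : Fin n) →
                        Σ (Mat n) λ M → Invertible M × (∀ b → M i b ≈ r b)
  invertible-with-row r {k} rₖs≈1 i =
    permutationMatrix τ *ₘ Iₘ-withRow k r ,
    Invertible-*ₘ (Invertible-permutationMatrix τ) (Invertible-Iₘ-withRow k r rₖs≈1) ,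
    λ b → trans (permutationMatrix-*ₘ τ (Iₘ-withRow k r) i b) (reflexive (≡.cong-app row-i b))
    where
    τ = transpose i k
    row-i : Iₘ-withRow k r (τ ⟨$⟩ʳ i) ≡ r
    row-i = ≡.trans (≡.cong (Iₘ-withRow k r) (transpose-matchˡ i k)) (Iₘ-withRow-self k r)

  unitEntry⇒singular-with-invertible-difference :
    ¬ (0# ≈ 1#) → ∀ {n} (A : Mat n) {i k s} → A i k * s ≈ 1# →
    Σ (Mat n) λ B → ¬ Invertible B × Invertible (A -ₘ B)
  unitEntry⇒singular-with-invertible-difference 0≉1 A {i} Aᵢₖs≈1
    with invertible-with-row (A i) Aᵢₖs≈1 i
  ... | M , M-invertible , Mᵢ≈Aᵢ =
    A -ₘ M ,
    zeroRow⇒¬Invertible 0≉1 (A -ₘ M) i Aᵢ-Mᵢ≈0 ,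
    Invertible-cong (X-[X-Y]≈Y A M) M-invertible
    where
    Aᵢ-Mᵢ≈0 : ∀ b → A i b - M i b ≈ 0#
    Aᵢ-Mᵢ≈0 b = trans (+-congˡ (-‿cong (Mᵢ≈Aᵢ b))) (-‿inverseʳ (A i b))

module _ {c ℓ : Level} (R : CommutativeRing c ℓ) where
  open CommutativeRing R hiding (zero)
  open Matrices R

  IsFinite⇒≈-decidable : IsFinite R → Decidable _≈_
  IsFinite⇒≈-decidable (_ , ι) = inj⇒≟ (Inverse⇒Injection ι)

  nonzero-entry : Decidable _≈_ → ∀ {n} (A : Mat n) → ¬ (A ≈ₘ 0ₘ) → ∃₂ λ i k → ¬ (A i k ≈ 0#)
  nonzero-entry _≈?_ {n} A A≉0 with ¬∀⟶∃¬ n _ (λ i → all? (λ j → A i j ≈? 0#)) A≉0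
  ... | i , Aᵢ≉0 with ¬∀⟶∃¬ n _ (λ j → A i j ≈? 0#) Aᵢ≉0
  ...   | k , Aᵢₖ≉0 = i , k , Aᵢₖ≉0

lemma3p2 : ∀ {c ℓ : Level} (F : CommutativeRing c ℓ) → IsField F → IsFinite F →
           (n : ℕ) → n > 1 →
           let open Matrices F in
           (A : Mat n) → ¬ (A ≈ₘ 0ₘ) →
           Σ (Mat n) λ B → ¬ Invertible B × Invertible (A -ₘ B)
lemma3p2 F isField finite n _ A A≉0 =
  let open IsField isField
      (i , k , Aᵢₖ≉0) = nonzero-entry F (IsFinite⇒≈-decidable F finite) A A≉0
      (_ , Aᵢₖs≈1)    = inverse (A i k) Aᵢₖ≉0
  in  MatrixAlgebra.unitEntry⇒singular-with-invertible-difference F 0≉1 A Aᵢₖs≈1
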